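{- Let $s$ be a string over a finite totally ordered alphabet and let $s=f_1f_2\cdots f_k$ be its Lyndon factorization. Suppose $s[1..i]$ is the shortest prefix of $s$ that is both border-free and not a Lyndon word. Then $i>\mathrm{end}(f_1)$, where $\mathrm{end}(f_1)=|f_1|$ is the index in $s$ of the last letter of $f_1$.
   Context: A Lyndon word is a nonempty string strictly lexicographically smaller than each of its nonempty proper suffixes. Every string $s$ can be written uniquely as $s=f_1f_2\cdots f_k$ with each $f_j$ a Lyndon word and $f_1\ge f_2\ge\cdots\ge f_k$ lexicographically; this is the Lyndon factorization. A border of a string $w$ is a string that is both a prefix and a suffix of $w$ and differs from $w$; $w$ is border-free if its only border is the empty string. -}

module Defs where

open import Data.Nat using (ℕ)
open import Data.Fin using (Fin)
import Data.Fin as F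
open import Data.List using (List; []; _∷_; _++_; concat)
open import Data.List.Relation.Unary.All using (All)
open import Data.List.Relation.Unary.Linked using (Linked)
open import Data.List.Relation.Binary.Lex.Strict using (Lex-<)
open import Data.Product using (_×_; ∃)
open import Data.Sum using (_⊎_)
open import Relation.Binary.PropositionalEquality using (_≡_; _≢_)

Str : ℕ → Set
Str σ = List (Fin σ)

-- Strict lexicographic order (a proper prefix is smaller).
_<ₗ_ : ∀ {σ} → Str σ → Str σ → Set
_<ₗ_ = Lex-< _≡_ F._<_

_≤ₗ_ : ∀ {σ} → Str σ → Str σ → Set
u ≤ₗ v = (u <ₗ v) ⊎ (u ≡ v)

IsLyndon : ∀ {σ} → Str σ → Set
IsLyndon w = (w ≢ []) × (∀ u v → u ≢ [] → v ≢ [] → u ++ v ≡ w → w <ₗ v)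

IsPrefix IsSuffix : ∀ {σ} → Str σ → Str σ → Set
IsPrefix b w = ∃ λ t → b ++ t ≡ w
IsSuffix b w = ∃ λ t → t ++ b ≡ w

IsBorder : ∀ {σ} → Str σ → Str σ → Set
IsBorder b w = IsPrefix b w × IsSuffix b w × (b ≢ w)

BorderFree : ∀ {σ} → Str σ → Set
BorderFree w = ∀ b → IsBorder b w → b ≡ []

IsLyndonFactorization : ∀ {σ} → Str σ → List (Str σ) → Set
IsLyndonFactorization s fs =
  (concat fs ≡ s) × All IsLyndon fs × Linked (λ f g → g ≤ₗ f) fs

module Submission where

-- If i ≤ |f₁|, then s[1..i] is a prefix of the Lyndon word f₁,
-- and we show that a nonempty border-free prefix p of a Lyndon word w is
-- itself Lyndon, contradicting ¬ IsLyndon (take i s).  Write w = p r and let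
-- p = u v with u, v nonempty.  Since w is Lyndon, p r = w <ₗ v r.  Because
-- |v| ≤ |p|, comparing p r with v r either gives p <ₗ v already inside the
-- first |v| letters, or shows that v is a prefix of p.  In the second case v
-- is a proper suffix and a prefix of p, i.e. a nonempty border -- impossible.
-- So p <ₗ v for every nonempty proper suffix v, and p is Lyndon.

open import Defs
open import Data.Nat using (ℕ; _≤_; _<_; zero; suc; s≤s)
open import Data.Nat.Properties using (<-irrefl; ≰⇒>; _≤?_)
open import Data.List using (List; []; _∷_; take; drop; length; _++_)
open import Data.List.Properties using (take++drop≡id; length-++-≤ʳ; ++-assoc; ++-conicalˡ)
open import Data.List.Relation.Binary.Lex.Strict using (this; next)
import Data.List.Relation.Unary.All as All
open import Data.Product using (_×_; _,_)
open import Data.Sum using (inj₁; inj₂; _⊎_)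
open import Data.Empty using (⊥-elim)
open import Relation.Nullary using (¬_; yes; no)
open import Relation.Binary.PropositionalEquality

module _ {σ : ℕ} where

  lex-truncate : ∀ (p r v t : Str σ) → length v ≤ length p →
                 (p ++ r) <ₗ (v ++ t) → (p <ₗ v) ⊎ IsPrefix v p
  lex-truncate p       r []      t _       _              = inj₂ (p , refl)
  lex-truncate (y ∷ p) r (x ∷ v) t (s≤s _) (this y<x)     = inj₁ (this y<x)
  lex-truncate (y ∷ p) r (x ∷ v) t (s≤s |v|≤|p|) (next y≡x p<v)
    with lex-truncate p r v t |v|≤|p| p<v
  ... | inj₁ p<v          = inj₁ (next y≡x p<v)
  ... | inj₂ (q , v++q≡p) = inj₂ (q , cong₂ _∷_ (sym y≡x) v++q≡p)

  suffix-length : ∀ (u v p : Str σ) → u ++ v ≡ p → length v ≤ length p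
  suffix-length u v p u++v≡p = subst (length v ≤_) (cong length u++v≡p) (length-++-≤ʳ v {u})

  proper-suffix-≢ : ∀ (u v p : Str σ) → u ≢ [] → u ++ v ≡ p → v ≢ p
  proper-suffix-≢ []      v p u≢[] _ _ = u≢[] refl
  proper-suffix-≢ (x ∷ u) v p _ x∷u++v≡v refl =
    <-irrefl (sym (cong length x∷u++v≡v)) (s≤s (length-++-≤ʳ v {u}))

  borderFree-prefix-Lyndon : ∀ (p r w : Str σ) → p ++ r ≡ w → p ≢ [] →
                             IsLyndon w → BorderFree p → IsLyndon p
  borderFree-prefix-Lyndon p r w p++r≡w p≢[] (_ , w-smallest) borderFree =
    p≢[] , smaller-than-suffix
    where
    smaller-than-suffix : ∀ u v → u ≢ [] → v ≢ [] → u ++ v ≡ p → p <ₗ v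
    smaller-than-suffix u v u≢[] v≢[] u++v≡p
      with lex-truncate p r v r (suffix-length u v p u++v≡p) p++r<v++r
      where
      u++v++r≡w : u ++ (v ++ r) ≡ w
      u++v++r≡w = begin
        u ++ (v ++ r) ≡⟨ ++-assoc u v r ⟨
        (u ++ v) ++ r ≡⟨ cong (_++ r) u++v≡p ⟩
        p ++ r        ≡⟨ p++r≡w ⟩
        w             ∎
        where open ≡-Reasoning

      p++r<v++r : (p ++ r) <ₗ (v ++ r)
      p++r<v++r = subst (_<ₗ (v ++ r)) (sym p++r≡w)
        (w-smallest u (v ++ r) u≢[] (λ v++r≡[] → v≢[] (++-conicalˡ v r v++r≡[])) u++v++r≡w)
    ... | inj₁ p<v        = p<v
    ... | inj₂ v-prefix-p =
      ⊥-elim (v≢[] (borderFree v (v-prefix-p , (u , u++v≡p) , proper-suffix-≢ u v p u≢[] u++v≡p)))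

  take-++-≤ : ∀ i (xs ys : Str σ) → i ≤ length xs → take i (xs ++ ys) ≡ take i xs
  take-++-≤ zero    xs       ys _            = refl
  take-++-≤ (suc i) (x ∷ xs) ys (s≤s i≤|xs|) = cong (x ∷_) (take-++-≤ i xs ys i≤|xs|)

  borderFree-take-Lyndon : ∀ (w : Str σ) i → 1 ≤ i → i ≤ length w →
                           IsLyndon w → BorderFree (take i w) → IsLyndon (take i w)
  borderFree-take-Lyndon (x ∷ w) (suc i) _ _ =
    borderFree-prefix-Lyndon (take (suc i) (x ∷ w)) (drop (suc i) (x ∷ w)) (x ∷ w)
      (take++drop≡id (suc i) (x ∷ w)) (λ ())

mainTheorem4 : ∀ {σ : ℕ} (s : Str σ) (f₁ : Str σ) (fs : List (Str σ)) →
    IsLyndonFactorization s (f₁ ∷ fs) →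
    (i : ℕ) → 1 ≤ i → i ≤ length s →
    BorderFree (take i s) → ¬ IsLyndon (take i s) →
    (∀ j → 1 ≤ j → j < i → ¬ (BorderFree (take j s) × ¬ IsLyndon (take j s))) →
    length f₁ < i
mainTheorem4 s f₁ fs (concat≡s , f₁-Lyndon All.∷ _ , _) i 1≤i _ borderFree notLyndon _
  with i ≤? length f₁
... | no  i≰|f₁| = ≰⇒> i≰|f₁|
... | yes i≤|f₁| = ⊥-elim (notLyndon (subst IsLyndon (sym prefix-in-f₁)
      (borderFree-take-Lyndon f₁ i 1≤i i≤|f₁| f₁-Lyndon
        (subst BorderFree prefix-in-f₁ borderFree))))
  where
  prefix-in-f₁ : take i s ≡ take i f₁
  prefix-in-f₁ = trans (cong (take i) (sym concat≡s)) (take-++-≤ i f₁ _ i≤|f₁|)
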